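{- Let $P$ be a finite poset, $Q=\{q_1,\dots,q_r\}\subseteq P$ with the induced order, and for each valid permutation $w\in S_r$ let $T_w=N'_w-\sum_{k=1}^r(k-1)e_{w(k)}\subset\mathbb{R}^r$ be the translated block (see context). If $w\neq v$ are two valid permutations, then $T_w$ and $T_v$ have disjoint interiors.
   Context: Let $\hat P$ be $P$ with a new minimum $\hat0$ and new maximum $\hat1$ adjoined. A permutation $w\in S_r$ is valid if $q_{w(1)}<\cdots<q_{w(r)}$ is consistent with the order of $P$ (i.e. $q_a<q_b$ in $P$ implies $w^{ -1}(a)<w^{ -1}(b)$). For valid $w$, let $P_w$ be the poset on $\hat P$ whose order is the transitive closure of the order of $\hat P$ together with $q_{w(1)}<q_{w(2)}<\cdots<q_{w(r)}$; write $<_w$ for it. Put $q^w_0=\hat0$, $q^w_k=q_{w(k)}$ ($1\le k\le r$), $q^w_{r+1}=\hat1$. Define $B^w_{1,1}=\{p:q^w_0\le_w p\le_w q^w_1\}$, $B^w_{i,i}=\{p:q^w_{i-1}<_w p\le_w q^w_i\}$ for $2\le i\le r+1$, and for $1\le i<j\le r+1$, $B^w_{i,j}=\{p:q^w_{i-1}<_w p<_w q^w_j,\ q^w_i\not\le_w p,\ p\not\le_w q^w_{j-1}\}$. Let $\varphi_w:\mathbb{R}^{r+1}\to\mathbb{R}^r$ be the linear map with $\varphi_w(x)_{w(k)}=x_1+\cdots+x_k$ for $1\le k\le r$, and $\Delta_{[i,j]}=\mathrm{conv}(e_i,\dots,e_j)\subset\mathbb{R}^{r+1}$. The block is the Minkowski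 sum $N'_w=\sum_{1\le i\le j\le r+1}|B^w_{i,j}|\,\varphi_w(\Delta_{[i,j]})$ (dilations by nonnegative integers, $0\cdot\Delta=\{0\}$); its integer points are the vectors $(\sigma(q_1),\dots,\sigma(q_r))$ for linear extensions $\sigma$ of $\hat P$ with $\sigma(q_{w(1)})<\cdots<\sigma(q_{w(r)})$.
   Formalization: The translated blocks $T_w$, $T_v$ and their interiors are taken in ℚ^r instead of ℝ^r, with rational Minkowski decompositions and rational centres, radii and points for the interior balls. -}

module Defs where

open import Data.Nat as ℕ using (ℕ; zero; suc; _≤ᵇ_)
open import Data.Fin as Fin using (Fin; toℕ)
open import Data.Fin.Permutation using (Permutation′; _⟨$⟩ʳ_; _⟨$⟩ˡ_)
open import Data.Integer using (+_)
open import Data.Rational as ℚ using (ℚ; 0ℚ; _/_; ∣_∣)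
open import Data.Bool using (if_then_else_)
open import Data.List using (List; length)
open import Data.List.Membership.Propositional using (_∈_)
open import Data.List.Relation.Unary.Unique.Propositional using (Unique)
open import Data.Product using (Σ; ∃; ∃-syntax; _×_)
open import Data.Sum using (_⊎_)
open import Relation.Binary.PropositionalEquality using (_≡_; _≢_)
open import Relation.Nullary using (¬_)
open import Function.Bundles using (_⇔_)

-- Finite poset P = (Fin n, _≤P_); Q = {q 0, …, q (r-1)} (0-indexed:
-- q i stands for q_{i+1} of the paper).

data Hat (n : ℕ) : Set where
  bot : Hat n
  el  : Fin n → Hat n
  top : Hat n

module Blocks {n r : ℕ} (_≤P_ : Fin n → Fin n → Set)
              (q : Fin r → Fin n) (w : Permutation′ r) where

  data _≤̂_ : Hat n → Hat n → Set where
    bot≤ : ∀ {x} → bot ≤̂ x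
    ≤top : ∀ {x} → x ≤̂ top
    el≤el : ∀ {a b} → a ≤P b → el a ≤̂ el b

  data _≤w_ : Hat n → Hat n → Set where
    base  : ∀ {x y} → x ≤̂ y → x ≤w y
    chain : ∀ (k l : Fin r) → toℕ k ℕ.< toℕ l →
            el (q (w ⟨$⟩ʳ k)) ≤w el (q (w ⟨$⟩ʳ l))
    trans : ∀ {x y z} → x ≤w y → y ≤w z → x ≤w z

  _<w_ : Hat n → Hat n → Set
  x <w y = x ≤w y × x ≢ y

  -- q^w_k for k = 0, …, r+1 (and 1̂ beyond)
  qw : ℕ → Hat n
  qw zero = bot
  qw (suc k) with k ℕ.<? r
  ... | Relation.Nullary.yes k<r = el (q (w ⟨$⟩ʳ Fin.fromℕ< k<r))
  ... | Relation.Nullary.no _    = top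

  -- the blocks B^w_{i,j}, with 1-based indices i, j ∈ {1, …, r+1}
  B : ℕ → ℕ → Hat n → Set
  B i j p with i ℕ.≟ j
  B i j p | Relation.Nullary.yes _ with i
  ... | 1 = (qw 0 ≤w p) × (p ≤w qw 1)
  ... | i′ = (qw (i′ ℕ.∸ 1) <w p) × (p ≤w qw i′)
  B i j p | Relation.Nullary.no _ =
      (qw (i ℕ.∸ 1) <w p) × (p <w qw j)
    × (¬ (qw i ≤w p)) × (¬ (p ≤w qw (j ℕ.∸ 1)))

Card : {n : ℕ} → (Hat n → Set) → ℕ → Set
Card {n} S m = Σ (List (Hat n)) λ L →
  Unique L × length L ≡ m × (∀ x → (x ∈ L) ⇔ S x)

sumFin : ∀ {m} → (Fin m → ℚ) → ℚ
sumFin {zero} f = 0ℚ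
sumFin {suc m} f = f Fin.zero ℚ.+ sumFin (λ i → f (Fin.suc i))

ℕtoℚ : ℕ → ℚ
ℕtoℚ k = (+ k) / 1

-- φ_w : ℝ^{r+1} → ℝ^r,  φ_w(z)_{w(k)} = z_1 + … + z_k  (coordinates of
-- ℝ^{r+1} indexed by Fin (suc r), t ↔ e_{t+1})
φ : ∀ {r} → Permutation′ r → (Fin (suc r) → ℚ) → Fin r → ℚ
φ w z a = sumFin (λ t → if toℕ t ≤ᵇ toℕ (w ⟨$⟩ˡ a) then z t else 0ℚ)

-- membership in N'_w = Σ_{1≤i≤j≤r+1} |B^w_{i,j}| φ_w(Δ_{[i,j]}).
-- Index pairs (i , j) : Fin (suc r) stand for (i+1 , j+1).  A point of
-- c·Δ_{[i,j]} is a nonnegative vector supported on [i,j] with coordinate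
-- sum c; pairs with i > j contribute {0}.
InN : ∀ {n r} (_≤P_ : Fin n → Fin n → Set) (q : Fin r → Fin n)
      (w : Permutation′ r) → (Fin r → ℚ) → Set
InN {n} {r} _≤P_ q w x =
  Σ (Fin (suc r) → Fin (suc r) → ℕ) λ c → ((∀ (i j : Fin (suc r)) → toℕ i ℕ.≤ toℕ j →
            Card (Blocks.B _≤P_ q w (suc (toℕ i)) (suc (toℕ j))) (c i j))
  × Σ (Fin (suc r) → Fin (suc r) → Fin (suc r) → ℚ) λ y → ((∀ (i j t : Fin (suc r)) → 0ℚ ℚ.≤ y i j t)
          × (∀ (i j t : Fin (suc r)) → (toℕ t ℕ.< toℕ i ⊎ toℕ j ℕ.< toℕ t)
               → y i j t ≡ 0ℚ)
          × (∀ (i j : Fin (suc r)) → toℕ i ℕ.≤ toℕ j →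
               sumFin (y i j) ≡ ℕtoℚ (c i j))
          × (∀ a → x a ≡ φ w (λ t → sumFin (λ i → sumFin (λ j → y i j t))) a)))

-- T_w = N'_w − Σ_k (k−1) e_{w(k)};  the shift at coordinate a = w(k) is
-- k − 1 = toℕ (w⁻¹ a) (0-based).
InT : ∀ {n r} (_≤P_ : Fin n → Fin n → Set) (q : Fin r → Fin n)
      (w : Permutation′ r) → (Fin r → ℚ) → Set
InT _≤P_ q w x = InN _≤P_ q w (λ a → x a ℚ.+ ℕtoℚ (toℕ (w ⟨$⟩ˡ a)))

-- interior point (sup-norm balls; rational points)
Interior : ∀ {r} → ((Fin r → ℚ) → Set) → (Fin r → ℚ) → Set
Interior T x = Σ ℚ λ ε → (0ℚ ℚ.< ε ×
  (∀ y → (∀ a → ∣ y a ℚ.- x a ∣ ℚ.< ε) → T y))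

Valid : ∀ {n r} (_≤P_ : Fin n → Fin n → Set) (q : Fin r → Fin n)
        (w : Permutation′ r) → Set
Valid _≤P_ q w = ∀ a b → q a ≤P q b → q a ≢ q b →
  toℕ (w ⟨$⟩ˡ a) ℕ.< toℕ (w ⟨$⟩ˡ b)

-- Every point x of T_w is weakly increasing along w, x_{w(1)} ≤ ⋯ ≤ x_{w(r)}.  Indeed the
-- coordinates x_{w(k)} + (k-1) are the partial sums z_1 + ⋯ + z_k of the point z of
-- Σ |B_{i,j}| Δ_{[i,j]} mapped by φ_w, and z_{k+1} ≥ |B_{k+1,k+1}| ≥ 1 because
-- q_{w(k+1)} ∈ B_{k+1,k+1}; so consecutive coordinates differ by z_{k+1} - 1 ≥ 0.
-- If w ≠ v there are a, b with a before b in w but after b in v.  An interior point x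
-- of T_w stays in T_w when x_a is raised a little, which forces x_a < x_b, while
-- x ∈ T_v gives x_b ≤ x_a.

module Submission where

open import Defs
open import Data.Nat using (ℕ)
open import Data.Fin using (Fin)
open import Data.Fin.Permutation using (Permutation′; _⟨$⟩ʳ_)
open import Data.Rational using (ℚ)
open import Data.Product using (_×_)
open import Relation.Binary.PropositionalEquality using (_≡_)
open import Relation.Binary.Structures using (IsPartialOrder)
open import Relation.Nullary using (¬_)
open import Function.Definitions using (Injective)

open import Algebra.Properties.AbelianGroup using (xyx⁻¹≈y; //-rightDividesʳ)
open import Data.Bool using (if_then_else_)
open import Data.Empty using (⊥-elim)
open import Data.Fin using (toℕ; fromℕ<; inject; Fin′) renaming (zero to fzero; suc to fsuc)
open import Data.Fin.Permutation using (_⟨$⟩ˡ_; inverseˡ; inverseʳ)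
open import Data.Fin.Properties
  using (toℕ-injective; toℕ<n; toℕ-fromℕ<; fromℕ<-toℕ; toℕ-inject; ¬∀⟶∃¬-smallest)
  renaming (_≟_ to _≟ᶠ_)
import Data.Integer as ℤ
import Data.Integer.Properties as ℤ
open import Data.Nat.Coprimality using (1-coprimeTo) renaming (sym to coprime-sym)
open import Data.List using ([]; _∷_)
open import Data.Nat as ℕ using (zero; suc; _≤ᵇ_; s≤s; z<s)
import Data.Nat.Properties as ℕ
open import Data.Product using (∃; _,_)
open import Data.Rational using (0ℚ; 1ℚ; mkℚ; _/_; _≤_; _<_; _+_; -_; _-_; ∣_∣)
open import Data.Rational.Properties
open import Data.Sum using (_⊎_; inj₁; inj₂)
open import Data.Vec.Functional using (updateAt)
open import Data.Vec.Functional.Properties using (updateAt-updates; updateAt-minimal)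
open import Function.Base using (_∘_)
open import Function.Bundles using (Equivalence)
open import Relation.Binary.Definitions using (tri<; tri≈; tri>)
open import Relation.Binary.PropositionalEquality
  using (_≢_; refl; sym; trans; cong; cong₂; subst; subst₂; module ≡-Reasoning)
open import Relation.Nullary using (yes; no)

-- Replacing ℕtoℚ k by a literal mkℚ lets _+_ compute the sum as (k * 1 + 1) / 1.
ℕtoℚ-suc : ∀ k → ℕtoℚ (suc k) ≡ ℕtoℚ k + 1ℚ
ℕtoℚ-suc k = begin
  ℕtoℚ (suc k)            ≡⟨ cong (_/ 1) (cong ℤ.+_ (ℕ.+-comm 1 k)) ⟩
  ℤ.+ (k ℕ.+ 1) / 1       ≡⟨ cong (λ i → (i ℤ.+ ℤ.+ 1) / 1) (sym (ℤ.*-identityʳ (ℤ.+ k))) ⟩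
  mkℚ (ℤ.+ k) 0 k⊥1 + 1ℚ  ≡⟨ cong (_+ 1ℚ) (sym (↥p/↧p≡p (mkℚ (ℤ.+ k) 0 k⊥1))) ⟩
  ℕtoℚ k + 1ℚ             ∎
  where
  open ≡-Reasoning
  k⊥1 = coprime-sym (1-coprimeTo k)

0≤ℕtoℚ : ∀ k → 0ℚ ≤ ℕtoℚ k
0≤ℕtoℚ k = nonNegative⁻¹ (ℕtoℚ k) {{normalize-nonNeg k 1}}

1≤ℕtoℚ : ∀ {k} → 1 ℕ.≤ k → 1ℚ ≤ ℕtoℚ k
1≤ℕtoℚ {suc k} _ = begin
  1ℚ            ≡⟨ +-identityˡ 1ℚ ⟨
  0ℚ + 1ℚ       ≤⟨ +-monoˡ-≤ 1ℚ (0≤ℕtoℚ k) ⟩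
  ℕtoℚ k + 1ℚ   ≡⟨ ℕtoℚ-suc k ⟨
  ℕtoℚ (suc k)  ∎
  where open ≤-Reasoning

+-cancelʳ-≤ : ∀ r {p q} → p + r ≤ q + r → p ≤ q
+-cancelʳ-≤ r {p} {q} p+r≤q+r = subst₂ _≤_ (//-rightDividesʳ +-0-abelianGroup r p)
  (//-rightDividesʳ +-0-abelianGroup r q) (+-monoˡ-≤ (- r) p+r≤q+r)

∣p+d-p∣≡∣d∣ : ∀ p d → ∣ (p + d) - p ∣ ≡ ∣ d ∣
∣p+d-p∣≡∣d∣ p d = cong ∣_∣ (xyx⁻¹≈y +-0-abelianGroup p d)

sumFin-cong : ∀ {m} {f g : Fin m → ℚ} → (∀ i → f i ≡ g i) → sumFin f ≡ sumFin g
sumFin-cong {zero}  f≗g = refl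
sumFin-cong {suc m} f≗g = cong₂ _+_ (f≗g fzero) (sumFin-cong (λ i → f≗g (fsuc i)))

sumFin-nonNeg : ∀ {m} {f : Fin m → ℚ} → (∀ i → 0ℚ ≤ f i) → 0ℚ ≤ sumFin f
sumFin-nonNeg {zero}  f≥0 = ≤-refl
sumFin-nonNeg {suc m} f≥0 =
  +-mono-≤ (f≥0 fzero) (sumFin-nonNeg (λ i → f≥0 (fsuc i)))

term≤sumFin : ∀ {m} {f : Fin m → ℚ} → (∀ i → 0ℚ ≤ f i) → ∀ i → f i ≤ sumFin f
term≤sumFin {suc m} {f} f≥0 fzero = begin
  f fzero       ≡⟨ +-identityʳ (f fzero) ⟨
  f fzero + 0ℚ  ≤⟨ +-monoʳ-≤ (f fzero) (sumFin-nonNeg (λ i → f≥0 (fsuc i))) ⟩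
  sumFin f      ∎
  where open ≤-Reasoning
term≤sumFin {suc m} {f} f≥0 (fsuc i) = begin
  f (fsuc i)       ≡⟨ +-identityˡ (f (fsuc i)) ⟨
  0ℚ + f (fsuc i)  ≤⟨ +-mono-≤ (f≥0 fzero) (term≤sumFin (λ j → f≥0 (fsuc j)) i) ⟩
  sumFin f         ∎
  where open ≤-Reasoning

sumFin-zero : ∀ {m} {f : Fin m → ℚ} → (∀ i → f i ≡ 0ℚ) → sumFin f ≡ 0ℚ
sumFin-zero {zero}  f≗0 = refl
sumFin-zero {suc m} f≗0 = cong₂ _+_ (f≗0 fzero) (sumFin-zero (λ i → f≗0 (fsuc i)))

sumFin-concentrated : ∀ {m} {f : Fin m → ℚ} t →
  (∀ s → toℕ s ℕ.< toℕ t ⊎ toℕ t ℕ.< toℕ s → f s ≡ 0ℚ) → sumFin f ≡ f t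
sumFin-concentrated {suc m} {f} fzero f≗0 = begin
  f fzero + sumFin (λ s → f (fsuc s))  ≡⟨ cong (f fzero +_) (sumFin-zero (λ s → f≗0 (fsuc s) (inj₂ z<s))) ⟩
  f fzero + 0ℚ                         ≡⟨ +-identityʳ (f fzero) ⟩
  f fzero                              ∎
  where open ≡-Reasoning
sumFin-concentrated {suc m} {f} (fsuc t) f≗0 = begin
  f fzero + sumFin (λ s → f (fsuc s))  ≡⟨ cong₂ _+_ (f≗0 fzero (inj₁ z<s)) (sumFin-concentrated t f∘suc≗0) ⟩
  0ℚ + f (fsuc t)                      ≡⟨ +-identityˡ (f (fsuc t)) ⟩
  f (fsuc t)                           ∎
  where
  open ≡-Reasoning
  f∘suc≗0 : ∀ s → toℕ s ℕ.< toℕ t ⊎ toℕ t ℕ.< toℕ s → f (fsuc s) ≡ 0ℚ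
  f∘suc≗0 s (inj₁ s<t) = f≗0 (fsuc s) (inj₁ (s≤s s<t))
  f∘suc≗0 s (inj₂ t<s) = f≗0 (fsuc s) (inj₂ (s≤s t<s))

prefixSum : ∀ {m} → (Fin m → ℚ) → ℕ → ℚ
prefixSum z k = sumFin (λ t → if toℕ t ≤ᵇ k then z t else 0ℚ)

suc≤ᵇsuc : ∀ i k → (suc i ≤ᵇ suc k) ≡ (i ≤ᵇ k)
suc≤ᵇsuc zero    k = refl
suc≤ᵇsuc (suc i) k = refl

prefixSum-zero : ∀ {m} (z : Fin (suc m) → ℚ) → prefixSum z 0 ≡ z fzero
prefixSum-zero {m} z =
  trans (cong (z fzero +_) (sumFin-zero {m} (λ _ → refl))) (+-identityʳ (z fzero))

prefixSum-suc : ∀ {m} (z : Fin (suc m) → ℚ) k →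
  prefixSum z (suc k) ≡ z fzero + prefixSum (λ t → z (fsuc t)) k
prefixSum-suc z k = cong (z fzero +_)
  (sumFin-cong (λ t → cong (λ b → if b then z (fsuc t) else 0ℚ) (suc≤ᵇsuc (toℕ t) k)))

prefixSum-step : ∀ {m} (z : Fin m → ℚ) (t : Fin m) k →
  toℕ t ≡ suc k → prefixSum z (suc k) ≡ prefixSum z k + z t
prefixSum-step z (fsuc fzero) zero refl = begin
  prefixSum z 1                             ≡⟨ prefixSum-suc z 0 ⟩
  z fzero + prefixSum (λ t → z (fsuc t)) 0  ≡⟨ cong (z fzero +_) (prefixSum-zero (λ t → z (fsuc t))) ⟩
  z fzero + z (fsuc fzero)                  ≡⟨ cong (_+ z (fsuc fzero)) (prefixSum-zero z) ⟨
  prefixSum z 0 + z (fsuc fzero)            ∎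
  where open ≡-Reasoning
prefixSum-step z (fsuc t) (suc k) t≡1+k = begin
  prefixSum z (suc (suc k))                   ≡⟨ prefixSum-suc z (suc k) ⟩
  z fzero + prefixSum z∘suc (suc k)           ≡⟨ cong (z fzero +_) (prefixSum-step z∘suc t k (ℕ.suc-injective t≡1+k)) ⟩
  z fzero + (prefixSum z∘suc k + z (fsuc t))  ≡⟨ +-assoc (z fzero) _ _ ⟨
  (z fzero + prefixSum z∘suc k) + z (fsuc t)  ≡⟨ cong (_+ z (fsuc t)) (prefixSum-suc z k) ⟨
  prefixSum z (suc k) + z (fsuc t)            ∎
  where
  open ≡-Reasoning
  z∘suc : Fin _ → ℚ
  z∘suc s = z (fsuc s)

diagonal≤column : ∀ {m} (y : Fin m → Fin m → Fin m → ℚ) →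
  (∀ i j t → 0ℚ ≤ y i j t) →
  (∀ i j t → toℕ t ℕ.< toℕ i ⊎ toℕ j ℕ.< toℕ t → y i j t ≡ 0ℚ) →
  ∀ t → sumFin (y t t) ≤ sumFin (λ i → sumFin (λ j → y i j t))
diagonal≤column y y≥0 supp t = begin
  sumFin (y t t)                         ≡⟨ sumFin-concentrated t (supp t t) ⟩
  y t t t                                ≤⟨ term≤sumFin (λ j → y≥0 t j t) t ⟩
  sumFin (λ j → y t j t)                 ≤⟨ term≤sumFin (λ i → sumFin-nonNeg (λ j → y≥0 i j t)) t ⟩
  sumFin (λ i → sumFin (λ j → y i j t))  ∎
  where open ≤-Reasoning

Card-nonempty : ∀ {n} {S : Hat n → Set} {m} {p} → Card S m → S p → 1 ℕ.≤ m
Card-nonempty {p = p} ([] , _ , _ , ∈L⇔S) p∈S with Equivalence.from (∈L⇔S p) p∈S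
... | ()
Card-nonempty (_ ∷ _ , _ , refl , _) _ = s≤s ℕ.z≤n

rank : ∀ {r} → Permutation′ r → Fin r → ℕ
rank w a = toℕ (w ⟨$⟩ˡ a)

AscendsAlong : ∀ {r} → Permutation′ r → (Fin r → ℚ) → Set
AscendsAlong w x = ∀ a b → rank w a ℕ.< rank w b → x a ≤ x b

adjacent⇒ascends : ∀ {r} (w : Permutation′ r) {x : Fin r → ℚ} →
  (∀ a b → rank w b ≡ suc (rank w a) → x a ≤ x b) → AscendsAlong w x
adjacent⇒ascends {r} w {x} step a b a<b =
  gap (rank w b ℕ.∸ suc (rank w a)) a b (sym (trans (sym (ℕ.+-suc _ (rank w a))) (ℕ.m∸n+n≡m a<b)))
  where
  gap : ∀ d a b → rank w b ≡ suc (d ℕ.+ rank w a) → x a ≤ x b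
  gap zero    a b b-next = step a b b-next
  gap (suc d) a b b-far  = ≤-trans (step a c c-next) (gap d c b b-far′)
    where
    c<r : suc (rank w a) ℕ.< r
    c<r = ℕ.≤-<-trans (s≤s (ℕ.m≤n+m (rank w a) (suc d))) (subst (ℕ._< r) b-far (toℕ<n (w ⟨$⟩ˡ b)))
    c : Fin r
    c = w ⟨$⟩ʳ fromℕ< c<r
    c-next : rank w c ≡ suc (rank w a)
    c-next = trans (cong toℕ (inverseˡ w)) (toℕ-fromℕ< c<r)
    b-far′ : rank w b ≡ suc (d ℕ.+ rank w c)
    b-far′ = trans b-far (cong suc (trans (sym (ℕ.+-suc d (rank w a))) (cong (d ℕ.+_) (sym c-next))))

module _ {n r : ℕ} (_≤P_ : Fin n → Fin n → Set) (q : Fin r → Fin n) (w : Permutation′ r) where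
  open Blocks _≤P_ q w hiding (trans)

  qw-rank : ∀ a → qw (suc (rank w a)) ≡ el (q a)
  qw-rank a with rank w a ℕ.<? r
  ... | yes a<r = cong (el ∘ q) (trans (cong (w ⟨$⟩ʳ_) (fromℕ<-toℕ (w ⟨$⟩ˡ a) a<r)) (inverseʳ w))
  ... | no  a≮r = ⊥-elim (a≮r (toℕ<n (w ⟨$⟩ˡ a)))

  successor∈diagonalBlock : (∀ {a} → a ≤P a) → Injective _≡_ _≡_ q →
    ∀ a b → rank w b ≡ suc (rank w a) →
    B (suc (suc (rank w a))) (suc (suc (rank w a))) (el (q b))
  successor∈diagonalBlock ≤P-refl q-inj a b b-next
    with suc (suc (rank w a)) ℕ.≟ suc (suc (rank w a))
  ... | no  ≢-refl = ⊥-elim (≢-refl refl)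
  ... | yes _      = (qa≤qb , qa≢qb) , qb≤qb
    where
    a<b : rank w a ℕ.< rank w b
    a<b = ℕ.≤-reflexive (sym b-next)
    qa≤qb : qw (suc (rank w a)) ≤w el (q b)
    qa≤qb = subst₂ _≤w_ (sym (qw-rank a)) (cong (el ∘ q) (inverseʳ w))
      (subst (λ u → el (q u) ≤w el (q (w ⟨$⟩ʳ (w ⟨$⟩ˡ b)))) (inverseʳ w)
        (chain (w ⟨$⟩ˡ a) (w ⟨$⟩ˡ b) a<b))
    qa≢qb : qw (suc (rank w a)) ≢ el (q b)
    qa≢qb qa≡qb = ℕ.<⇒≢ a<b (cong (rank w) (q-inj (el-injective (trans (sym (qw-rank a)) qa≡qb))))
      where
      el-injective : ∀ {u v} → el {n} u ≡ el v → u ≡ v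
      el-injective refl = refl
    qb≤qb : el (q b) ≤w qw (suc (suc (rank w a)))
    qb≤qb = subst (el (q b) ≤w_) (trans (sym (qw-rank b)) (cong (qw ∘ suc) b-next)) (base (el≤el ≤P-refl))

  InT⇒adjacent≤ : (∀ {a} → a ≤P a) → Injective _≡_ _≡_ q → ∀ {x} → InT _≤P_ q w x →
    ∀ a b → rank w b ≡ suc (rank w a) → x a ≤ x b
  InT⇒adjacent≤ ≤P-refl q-inj {x} (c , cards , y , y≥0 , supp , sums , x≡φ) a b b-next =
    +-cancelʳ-≤ (ℕtoℚ (suc k)) (begin
      x a + ℕtoℚ (suc k)   ≡⟨ cong (x a +_) (ℕtoℚ-suc k) ⟩
      x a + (ℕtoℚ k + 1ℚ)  ≡⟨ +-assoc (x a) (ℕtoℚ k) 1ℚ ⟨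
      (x a + ℕtoℚ k) + 1ℚ  ≡⟨ cong (_+ 1ℚ) (x≡φ a) ⟩
      prefixSum z k + 1ℚ   ≤⟨ +-monoʳ-≤ (prefixSum z k) 1≤zt ⟩
      prefixSum z k + z t  ≡⟨ prefixSum-step z t k refl ⟨
      prefixSum z (suc k)  ≡⟨ subst (λ j → x b + ℕtoℚ j ≡ prefixSum z j) b-next (x≡φ b) ⟨
      x b + ℕtoℚ (suc k)   ∎)
    where
    open ≤-Reasoning
    k : ℕ
    k = rank w a
    t : Fin (suc r)
    t = fsuc (w ⟨$⟩ˡ a)
    z : Fin (suc r) → ℚ
    z u = sumFin (λ i → sumFin (λ j → y i j u))
    1≤zt : 1ℚ ≤ z t
    1≤zt = begin
      1ℚ              ≤⟨ 1≤ℕtoℚ (Card-nonempty (cards t t ℕ.≤-refl)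
                                (successor∈diagonalBlock ≤P-refl q-inj a b b-next)) ⟩
      ℕtoℚ (c t t)    ≡⟨ sums t t ℕ.≤-refl ⟨
      sumFin (y t t)  ≤⟨ diagonal≤column y y≥0 supp t ⟩
      z t             ∎

  InT⇒ascends : (∀ {a} → a ≤P a) → Injective _≡_ _≡_ q →
    ∀ x → InT _≤P_ q w x → AscendsAlong w x
  InT⇒ascends ≤P-refl q-inj x x∈T = adjacent⇒ascends w (InT⇒adjacent≤ ≤P-refl q-inj x∈T)

interior⇒member : ∀ {r} {T : (Fin r → ℚ) → Set} {x} → Interior T x → T x
interior⇒member {x = x} (ε , 0<ε , ball⊆T) =
  ball⊆T x (λ a → subst (_< ε) (sym (cong ∣_∣ (+-inverseʳ (x a)))) 0<ε)

interior-of-ascending⇒< : ∀ {r} (w : Permutation′ r) {T : (Fin r → ℚ) → Set} →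
  (∀ y → T y → AscendsAlong w y) → ∀ {x} → Interior T x →
  ∀ a b → rank w a ℕ.< rank w b → x a < x b
interior-of-ascending⇒< w T⊆↑ {x} (ε , 0<ε , ball⊆T) a b a<b
  with <-dense 0<ε
... | δ , 0<δ , δ<ε = begin-strict
  x a       ≡⟨ +-identityʳ (x a) ⟨
  x a + 0ℚ  <⟨ +-monoʳ-< (x a) 0<δ ⟩
  x a + δ   ≡⟨ updateAt-updates a x ⟨
  y a       ≤⟨ T⊆↑ y (ball⊆T y y∈ball) a b a<b ⟩
  y b       ≡⟨ updateAt-minimal b a x b≢a ⟩
  x b       ∎
  where
  open ≤-Reasoning
  y = updateAt x a (_+ δ)
  b≢a : b ≢ a
  b≢a refl = ℕ.<-irrefl refl a<b
  y∈ball : ∀ c → ∣ y c - x c ∣ < ε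
  y∈ball c with c ≟ᶠ a
  ... | yes refl = subst (_< ε)
          (sym (trans (cong (λ u → ∣ u - x c ∣) (updateAt-updates c x))
                      (trans (∣p+d-p∣≡∣d∣ (x c) δ) (0≤p⇒∣p∣≡p (<⇒≤ 0<δ))))) δ<ε
  ... | no  c≢a  = subst (_< ε)
          (sym (trans (cong (λ u → ∣ u - x c ∣) (updateAt-minimal c a x c≢a))
                      (cong ∣_∣ (+-inverseʳ (x c))))) 0<ε

first-disagreement-later : ∀ {r} (w v : Permutation′ r) (i : Fin r) → w ⟨$⟩ʳ i ≢ v ⟨$⟩ʳ i →
  (∀ (j : Fin′ i) → w ⟨$⟩ʳ inject j ≡ v ⟨$⟩ʳ inject j) → toℕ i ℕ.< rank w (v ⟨$⟩ʳ i)
first-disagreement-later {r} w v i wi≢vi agree with ℕ.<-cmp (rank w (v ⟨$⟩ʳ i)) (toℕ i)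
... | tri> _ _ i<k = i<k
... | tri≈ _ rank≡i _ = ⊥-elim (wi≢vi (trans (cong (w ⟨$⟩ʳ_) (sym (toℕ-injective rank≡i))) (inverseʳ w)))
... | tri< k<i _ _ = ⊥-elim (ℕ.<⇒≢ k<i (cong toℕ k≡i))
  where
  k : Fin r
  k = w ⟨$⟩ˡ (v ⟨$⟩ʳ i)
  j : Fin′ i
  j = fromℕ< k<i
  inject-j≡k : inject j ≡ k
  inject-j≡k = toℕ-injective (trans (toℕ-inject j) (toℕ-fromℕ< k<i))
  vk≡vi : v ⟨$⟩ʳ k ≡ v ⟨$⟩ʳ i
  vk≡vi = trans (sym (subst (λ u → w ⟨$⟩ʳ u ≡ v ⟨$⟩ʳ u) inject-j≡k (agree j))) (inverseʳ w)
  k≡i : k ≡ i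
  k≡i = trans (sym (inverseˡ v)) (trans (cong (v ⟨$⟩ˡ_) vk≡vi) (inverseˡ v))

inversion : ∀ {r} (w v : Permutation′ r) → ¬ (∀ i → w ⟨$⟩ʳ i ≡ v ⟨$⟩ʳ i) →
  ∃ λ a → ∃ λ b → rank w a ℕ.< rank w b × rank v b ℕ.< rank v a
inversion {r} w v w≢v
  with ¬∀⟶∃¬-smallest r (λ i → w ⟨$⟩ʳ i ≡ v ⟨$⟩ʳ i) (λ i → w ⟨$⟩ʳ i ≟ᶠ v ⟨$⟩ʳ i) w≢v
... | i , wi≢vi , agree = w ⟨$⟩ʳ i , v ⟨$⟩ʳ i
  , subst (ℕ._< rank w (v ⟨$⟩ʳ i)) (sym (cong toℕ (inverseˡ w)))
      (first-disagreement-later w v i wi≢vi agree)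
  , subst (ℕ._< rank v (w ⟨$⟩ʳ i)) (sym (cong toℕ (inverseˡ v)))
      (first-disagreement-later v w i (wi≢vi ∘ sym) (sym ∘ agree))

lemma4p1 : (n r : ℕ) (_≤P_ : Fin n → Fin n → Set)
    → IsPartialOrder _≡_ _≤P_
    → (q : Fin r → Fin n) → Injective _≡_ _≡_ q
    → (w v : Permutation′ r)
    → Valid _≤P_ q w → Valid _≤P_ q v
    → ¬ (∀ i → w ⟨$⟩ʳ i ≡ v ⟨$⟩ʳ i)
    → (x : Fin r → ℚ)
    → ¬ (Interior (InT _≤P_ q w) x × Interior (InT _≤P_ q v) x)
lemma4p1 n r _≤P_ ≤P-partialOrder q q-inj w v _ _ w≢v x (x∈T°w , x∈T°v)
  with inversion w v w≢v
... | a , b , a<ᵂb , b<ⱽa = <-irrefl refl (<-≤-trans xa<xb xb≤xa)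
  where
  ≤P-refl : ∀ {p} → p ≤P p
  ≤P-refl = IsPartialOrder.refl ≤P-partialOrder
  xa<xb : x a < x b
  xa<xb = interior-of-ascending⇒< w (InT⇒ascends _≤P_ q w ≤P-refl q-inj) x∈T°w a b a<ᵂb
  xb≤xa : x b ≤ x a
  xb≤xa = InT⇒ascends _≤P_ q v ≤P-refl q-inj x (interior⇒member x∈T°v) b a b<ⱽa
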